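{- Let $m,n\ge 1$, $k\ge1$ and let $c:[m]\times[n]\to[k]$ be a colouring that maps onto $[k]$. Let $\mathscr{T}=(T,\mathcal{S},s,2)$ be a solution of the PATS problem for $c$ whose number of tile types $|T|$ is minimal among all solutions of the PATS problem for $c$. Then $\mathscr{T}$ is deterministic.
   Context: Notation: $[m]=\{1,\dots,m\}$, $[0,m]=\{0,1,\dots,m\}$. Directions $N,E,S,W:\mathbb{Z}^2\to\mathbb{Z}^2$ are $N(x,y)=(x,y+1)$, $E(x,y)=(x+1,y)$, $S=N^{ -1}$, $W=E^{ -1}$. Let $\Sigma$ be a set of glue types and $s:\Sigma\times\Sigma\to\mathbb{N}$ a symmetric glue strength function with $s(\sigma_1,\sigma_2)=0$ whenever $\sigma_1\ne\sigma_2$. A tile type is a quadruple $t=(\sigma_N(t),\sigma_E(t),\sigma_S(t),\sigma_W(t))\in\Sigma^4$. An assembly is a partial map $\mathbb{Z}^2\to\Sigma^4$. A tile assembly system (TAS) $\mathscr{T}=(T,\mathcal{S},s,\tau)$ consists of a finite set $T$ of tile types, a seed assembly $\mathcal{S}$, a glue strength function $s$, and a temperature $\tau\in\mathbb{Z}^+$. For assemblies $\mathcal{A},\mathcal{A}'$ write $\mathcal{A}\to_{\mathscr{T}}\mathcal{A}'$ if $\mathcal{A}'=\mathcal{A}\cup\{((x,y),t)\}$ (disjoint union) for some position $(x,y)$ and $t\in T$ with $\sum_D s(\sigma_D(t),\sigma_{D^{ -1}}(\mathcal{A}(D(x,y))))\ge\tau$, the sum over those $D\in\{N,E,S,W\}$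 with $\mathcal{A}(D(x,y))$ defined. Let $\to^*_{\mathscr{T}}$ be its reflexive transitive closure; $\mathscr{T}$ produces $\mathcal{A}$ if $\mathcal{S}\to^*_{\mathscr{T}}\mathcal{A}$. A produced assembly is terminal if it cannot be extended by $\to_{\mathscr{T}}$; $\mathrm{Term}\,\mathscr{T}$ denotes the set of terminal assemblies. $\mathscr{T}$ is deterministic if for every produced assembly $\mathcal{A}$ and every position $(x,y)$ there is at most one $t\in T$ with which $\mathcal{A}$ can be extended at $(x,y)$. PATS problem for $c$: find a TAS $\mathscr{T}=(T,\mathcal{S},s,2)$ such that (P1) the tiles in $T$ have bonding strength 1 (i.e. $s(\sigma,\sigma)=1$ for the glues $\sigma$ on tiles of $T$); (P2) the domain of $\mathcal{S}$ is $[0,m]\times\{0\}\cup\{0\}\times[0,n]$ and every terminal assembly has domain $[0,m]\times[0,n]$; (P3) there is a map $d:T\to[k]$ such that for every $\mathcal{A}\in\mathrm{Term}\,\mathscr{T}$ we have $d(\mathcal{A}(x,y))=c(x,y)$ for all $(x,y)\in[m]\times[n]$. Such a TAS is called a solution. -}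

module Defs where

open import Data.Nat as ℕ using (ℕ; zero; suc; _≤_)
open import Data.Integer as ℤ using (ℤ; +_)
open import Data.Fin using (Fin; toℕ)
open import Data.Maybe using (Maybe; just; nothing)
open import Data.Product using (Σ; ∃; _×_; _,_)
open import Data.Sum using (_⊎_)
open import Function.Definitions using (Injective)
open import Relation.Binary.PropositionalEquality using (_≡_; _≢_)
open import Relation.Binary.Construct.Closure.ReflexiveTransitive using (Star)
open import Relation.Nullary using (¬_)

Pos : Set
Pos = ℤ × ℤ

dirN dirE dirS dirW : Pos → Pos
dirN (x , y) = (x , y ℤ.+ ℤ.1ℤ)
dirE (x , y) = (x ℤ.+ ℤ.1ℤ , y)
dirS (x , y) = (x , y ℤ.- ℤ.1ℤ)
dirW (x , y) = (x ℤ.- ℤ.1ℤ , y)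

record Tile (Glue : Set) : Set where
  constructor tile
  field
    σN σE σS σW : Glue
open Tile public

Assembly : Set → Set
Assembly Glue = Pos → Maybe (Tile Glue)

Defined : {Glue : Set} → Assembly Glue → Pos → Set
Defined A p = ∃ λ t → A p ≡ just t

HasDomain : {Glue : Set} → Assembly Glue → (Pos → Set) → Set
HasDomain A D = ∀ p → (Defined A p → D p) × (D p → Defined A p)

-- A tile assembly system (T, 𝒮, s, τ) over glue set Glue.
-- The finite set T of tile types is given as an injective enumeration
-- tiles : Fin size → Tile Glue, so |T| = size.
record TAS (Glue : Set) : Set where
  field
    size     : ℕ
    tiles    : Fin size → Tile Glue
    tiles-inj : Injective _≡_ _≡_ tiles
    seed     : Assembly Glue
    str      : Glue → Glue → ℕ
    str-sym  : ∀ a b → str a b ≡ str b a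
    str-diff : ∀ a b → a ≢ b → str a b ≡ 0
    τ        : ℕ
    τ-pos    : 1 ≤ τ
open TAS public

module _ {Glue : Set} (𝒯 : TAS Glue) where

  contrib : Maybe (Tile Glue) → (Tile Glue → ℕ) → ℕ
  contrib nothing  f = 0
  contrib (just u) f = f u

  bindStrength : Assembly Glue → Pos → Tile Glue → ℕ
  bindStrength A p t =
    contrib (A (dirN p)) (λ u → str 𝒯 (σN t) (σS u)) ℕ.+
    contrib (A (dirE p)) (λ u → str 𝒯 (σE t) (σW u)) ℕ.+
    contrib (A (dirS p)) (λ u → str 𝒯 (σS t) (σN u)) ℕ.+
    contrib (A (dirW p)) (λ u → str 𝒯 (σW t) (σE u))

  CanExtendAt : Assembly Glue → Pos → Fin (size 𝒯) → Set
  CanExtendAt A p r = (A p ≡ nothing) × (τ 𝒯 ≤ bindStrength A p (tiles 𝒯 r))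

  Step : Assembly Glue → Assembly Glue → Set
  Step A A' = Σ Pos λ p → Σ (Fin (size 𝒯)) λ r →
    CanExtendAt A p r × (A' p ≡ just (tiles 𝒯 r)) × (∀ q → q ≢ p → A' q ≡ A q)

  Produces : Assembly Glue → Set
  Produces A = Star Step (seed 𝒯) A

  Terminal : Assembly Glue → Set
  Terminal A = Produces A × ¬ (∃ λ A' → Step A A')

  Deterministic : Set
  Deterministic = ∀ A → Produces A → ∀ p (r r' : Fin (size 𝒯)) →
    CanExtendAt A p r → CanExtendAt A p r' → r ≡ r'

SeedDom : ℕ → ℕ → Pos → Set
SeedDom m n (x , y) =
  ((+ 0 ℤ.≤ x × x ℤ.≤ + m) × y ≡ + 0) ⊎ (x ≡ + 0 × (+ 0 ℤ.≤ y × y ℤ.≤ + n))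

RectDom : ℕ → ℕ → Pos → Set
RectDom m n (x , y) = (+ 0 ℤ.≤ x × x ℤ.≤ + m) × (+ 0 ℤ.≤ y × y ℤ.≤ + n)

-- Colourings c : [m] × [n] → [k]; the element i : Fin m stands for the
-- coordinate toℕ i + 1 ∈ [m] (likewise for [n] and [k]).
Colouring : ℕ → ℕ → ℕ → Set
Colouring m n k = Fin m → Fin n → Fin k

Onto : ∀ {m n k} → Colouring m n k → Set
Onto {m} {n} {k} c = ∀ (j : Fin k) → ∃ λ (x : Fin m) → ∃ λ (y : Fin n) → c x y ≡ j

cellPos : ∀ {m n} → Fin m → Fin n → Pos
cellPos x y = (+ suc (toℕ x) , + suc (toℕ y))

IsSolution : ∀ {m n k} → Colouring m n k → {Glue : Set} → TAS Glue → Set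
IsSolution {m} {n} {k} c 𝒯 =
  (τ 𝒯 ≡ 2) ×
  (∀ r → let t = tiles 𝒯 r in
     (str 𝒯 (σN t) (σN t) ≡ 1) × (str 𝒯 (σE t) (σE t) ≡ 1) ×
     (str 𝒯 (σS t) (σS t) ≡ 1) × (str 𝒯 (σW t) (σW t) ≡ 1)) ×
  HasDomain (seed 𝒯) (SeedDom m n) ×
  (∀ A → Terminal 𝒯 A → HasDomain A (RectDom m n)) ×
  (Σ (Fin (size 𝒯) → Fin k) λ d →
     ∀ A → Terminal 𝒯 A → ∀ (x : Fin m) (y : Fin n) →
       ∃ λ r → (A (cellPos x y) ≡ just (tiles 𝒯 r)) × (d r ≡ c x y))

-- At temperature 2 with glues of strength 1, a tile needs two bonded neighbours.
-- Growing from the L-shaped seed inside the rectangle, the north and east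
-- neighbours of an empty position are still absent, so every tile attaches
-- through exactly its south and west neighbours.  Whether a tile type fits at a
-- position therefore depends only on its south and west glues, and two tile
-- types that both fit at the same position of some produced assembly fit at
-- exactly the same places.  If a solution is not deterministic, one of two
-- competing tile types can be dropped: every terminal assembly of the smaller
-- system is terminal for the original one, so the smaller system is still a
-- solution, contradicting minimality.
module Submission where

open import Defs
open import Data.Empty using (⊥-elim)
open import Data.Fin using (Fin; punchIn; punchOut) renaming (_≟_ to _≟ᶠ_)
open import Data.Fin.Properties using (punchIn-injective; punchIn-punchOut)
open import Data.Integer as ℤ using (+_; 1ℤ)
import Data.Integer.Properties as ℤ
open import Data.Maybe using (just; nothing)
open import Data.Maybe.Properties using (just-injective)
import Data.Nat as ℕ
open import Data.Nat using (ℕ; suc; _≤_; _<_; _+_; z≤n; s≤s; pred)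
open import Data.Nat.Properties using (≤-refl; <⇒≱; 0≢1+n; m+1+n≢0)
open import Data.Product using (∃; _×_; _,_; proj₁; proj₂)
open import Data.Product.Properties using (≡-dec)
open import Data.Sum using (_⊎_; inj₁; inj₂)
open import Function using (_∘_)
open import Relation.Binary.Construct.Closure.ReflexiveTransitive using (Star; ε; _◅_; map)
open import Relation.Binary.PropositionalEquality
open import Relation.Nullary using (¬_; Dec; yes; no; contradiction)
open import Relation.Nullary.Decidable using (decidable-stable; ¬¬-excluded-middle)

+1-1 : ∀ i → i ℤ.+ 1ℤ ℤ.- 1ℤ ≡ i
+1-1 i = begin
  i ℤ.+ 1ℤ ℤ.- 1ℤ      ≡⟨ ℤ.+-assoc i 1ℤ (ℤ.- 1ℤ) ⟩
  i ℤ.+ (1ℤ ℤ.- 1ℤ)    ≡⟨ cong (λ j → i ℤ.+ j) (ℤ.+-inverseʳ 1ℤ) ⟩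
  i ℤ.+ ℤ.0ℤ           ≡⟨ ℤ.+-identityʳ i ⟩
  i                    ∎
  where open ≡-Reasoning

0≤i⇒i+1≢0 : ∀ {i} → + 0 ℤ.≤ i → i ℤ.+ 1ℤ ≢ + 0
0≤i⇒i+1≢0 {+ k} _ e = m+1+n≢0 k (ℤ.+-injective e)

0≤i-1⇒0≤i : ∀ {i} → + 0 ℤ.≤ i ℤ.- 1ℤ → + 0 ℤ.≤ i
0≤i-1⇒0≤i {i} 0≤i-1 = ℤ.≤-trans 0≤i-1 (ℤ.i-j≤i i 1ℤ)

dirS-dirN : ∀ p → dirS (dirN p) ≡ p
dirS-dirN (x , y) = cong (x ,_) (+1-1 y)

dirW-dirE : ∀ p → dirW (dirE p) ≡ p
dirW-dirE (x , y) = cong (_, y) (+1-1 x)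

_≟ₚ_ : (p q : Pos) → Dec (p ≡ q)
_≟ₚ_ = ≡-dec ℤ._≟_ ℤ._≟_

SeedDom⇒RectDom : ∀ {m n} p → SeedDom m n p → RectDom m n p
SeedDom⇒RectDom _ (inj₁ (0≤x≤m , refl)) = 0≤x≤m , ℤ.+≤+ z≤n , ℤ.+≤+ z≤n
SeedDom⇒RectDom _ (inj₂ (refl , 0≤y≤n)) = (ℤ.+≤+ z≤n , ℤ.+≤+ z≤n) , 0≤y≤n

cellPos∉SeedDom : ∀ {m n} (x : Fin m) (y : Fin n) → ¬ SeedDom m n (cellPos x y)
cellPos∉SeedDom x y (inj₁ (_ , ()))
cellPos∉SeedDom x y (inj₂ (() , _))

lone-north : ∀ {a b c d} → a ≤ 1 → b ≡ 0 → c ≡ 0 → d ≡ 0 → a + b + c + d < 2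
lone-north z≤n       refl refl refl = s≤s z≤n
lone-north (s≤s z≤n) refl refl refl = s≤s (s≤s z≤n)

lone-east : ∀ {a b c d} → b ≤ 1 → a ≡ 0 → c ≡ 0 → d ≡ 0 → a + b + c + d < 2
lone-east z≤n       refl refl refl = s≤s z≤n
lone-east (s≤s z≤n) refl refl refl = s≤s (s≤s z≤n)

south-west-only : ∀ {a b c d} → c ≤ 1 → d ≤ 1 → a ≡ 0 → b ≡ 0 →
                  2 ≤ a + b + c + d → c ≡ 1 × d ≡ 1
south-west-only (s≤s z≤n) (s≤s z≤n) refl refl _ = refl , refl
south-west-only z≤n       z≤n       refl refl ()
south-west-only z≤n       (s≤s z≤n) refl refl (s≤s ())
south-west-only (s≤s z≤n) z≤n       refl refl (s≤s ())

punchIn′ : ∀ {k} → Fin k → Fin (pred k) → Fin k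
punchIn′ {suc k} = punchIn

punchIn′-injective : ∀ {k} (r : Fin k) {i j} → punchIn′ r i ≡ punchIn′ r j → i ≡ j
punchIn′-injective {suc k} r = punchIn-injective r _ _

punchIn′-punchOut : ∀ {k} {r j : Fin k} → j ≢ r → ∃ λ i → punchIn′ r i ≡ j
punchIn′-punchOut {suc k} j≢r = punchOut (j≢r ∘ sym) , punchIn-punchOut (j≢r ∘ sym)

pred<-Fin : ∀ {k} → Fin k → pred k < k
pred<-Fin {suc k} _ = ≤-refl

Star-invariant : ∀ {I : Set} {R : I → I → Set} (P : I → Set) →
                 (∀ {a b} → P a → R a b → P b) → ∀ {a b} → P a → Star R a b → P b
Star-invariant P step pa ε        = pa
Star-invariant P step pa (r ◅ rs) = Star-invariant P step (step pa r) rs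

free : ∀ {Glue} {A : Assembly Glue} {q} → ¬ Defined A q → A q ≡ nothing
free {A = A} {q} undefined with A q
... | nothing = refl
... | just t  = contradiction (t , refl) undefined

module _ {Glue : Set} (T : TAS Glue) where

  UnitStrength : Set
  UnitStrength = ∀ r → let t = tiles T r in
    (str T (σN t) (σN t) ≡ 1) × (str T (σE t) (σE t) ≡ 1) ×
    (str T (σS t) (σS t) ≡ 1) × (str T (σW t) (σW t) ≡ 1)

  SeedOrTile : Assembly Glue → Set
  SeedOrTile A = ∀ q → A q ≡ seed T q ⊎ ∃ λ r → A q ≡ just (tiles T r)

  Redundant : Fin (size T) → Set
  Redundant r = ∀ {A q} → Produces T A → CanExtendAt T A q r →
                ∃ λ j → j ≢ r × CanExtendAt T A q j

  removeTile : Fin (size T) → TAS Glue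
  removeTile r = record T
    { size      = pred (size T)
    ; tiles     = tiles T ∘ punchIn′ r
    ; tiles-inj = punchIn′-injective r ∘ tiles-inj T
    }

  -- Glue equality is not decidable, so "a and b match" is carried by the
  -- decidable equation str a b ≡ 1 and reasoned about under double negation.
  str≡1⇒¬¬≡ : ∀ {a b} → str T a b ≡ 1 → ¬ ¬ a ≡ b
  str≡1⇒¬¬≡ {a} {b} e a≢b = 0≢1+n (trans (sym (str-diff T a b a≢b)) e)

  str≤1 : ∀ {a} b → str T a a ≡ 1 → str T a b ≤ 1
  str≤1 {a} b aa = decidable-stable (str T a b ℕ.≤? 1) λ ≰1 →
    ¬¬-excluded-middle {A = a ≡ b} λ where
      (yes refl) → ≰1 (subst (_≤ 1) (sym aa) ≤-refl)
      (no a≢b)   → ≰1 (subst (_≤ 1) (sym (str-diff T a b a≢b)) z≤n)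

  str-zigzag : ∀ {α β γ δ} → str T α α ≡ 1 →
               str T α γ ≡ 1 → str T β γ ≡ 1 → str T β δ ≡ 1 → str T α δ ≡ 1
  str-zigzag αα αγ βγ βδ = decidable-stable (_ ℕ.≟ 1) λ αδ≢1 →
    str≡1⇒¬¬≡ αγ λ { refl → str≡1⇒¬¬≡ βγ λ { refl → str≡1⇒¬¬≡ βδ λ { refl → αδ≢1 αα } } }

  contrib≤1 : ∀ {a} mu (g : Tile Glue → Glue) → str T a a ≡ 1 →
              contrib T mu (λ u → str T a (g u)) ≤ 1
  contrib≤1 nothing  g aa = z≤n
  contrib≤1 (just u) g aa = str≤1 (g u) aa

  contrib≡1 : ∀ mu (f : Tile Glue → ℕ) → contrib T mu f ≡ 1 → ∃ λ u → mu ≡ just u × f u ≡ 1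
  contrib≡1 (just u) f e = u , refl , e

  contrib-nothing : ∀ {mu} (f : Tile Glue → ℕ) → mu ≡ nothing → contrib T mu f ≡ 0
  contrib-nothing f refl = refl

module _ {Glue : Set} {T : TAS Glue} where

  canExtend⇒step : ∀ {A p r} → CanExtendAt T A p r → ∃ (Step T A)
  canExtend⇒step {A} {p} {r} ext = A′ , p , r , ext , A′-at-p , A′-elsewhere
    where
    A′ : Assembly Glue
    A′ q with q ≟ₚ p
    ... | yes _ = just (tiles T r)
    ... | no _  = A q
    A′-at-p : A′ p ≡ just (tiles T r)
    A′-at-p with p ≟ₚ p
    ... | yes _   = refl
    ... | no p≢p = contradiction refl p≢p
    A′-elsewhere : ∀ q → q ≢ p → A′ q ≡ A q
    A′-elsewhere q q≢p with q ≟ₚ p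
    ... | yes q≡p = contradiction q≡p q≢p
    ... | no _    = refl

  produced⇒seedOrTile : ∀ {A} → Produces T A → SeedOrTile T A
  produced⇒seedOrTile = Star-invariant (SeedOrTile T) step (λ _ → inj₁ refl)
    where
    step : ∀ {A A′} → SeedOrTile T A → Step T A A′ → SeedOrTile T A′
    step sot (p , r , _ , at-p , elsewhere) q with q ≟ₚ p | sot q
    ... | yes refl | _             = inj₂ (r , at-p)
    ... | no q≢p   | inj₁ seed-q   = inj₁ (trans (elsewhere q q≢p) seed-q)
    ... | no q≢p   | inj₂ (s , at) = inj₂ (s , trans (elsewhere q q≢p) at)

module _ {Glue : Set} {T : TAS Glue} where

  removeTile-size< : ∀ r → size (removeTile T r) < size T
  removeTile-size< = pred<-Fin

  removeTile-produces : ∀ {r A} → Produces (removeTile T r) A → Produces T A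
  removeTile-produces {r} = map λ (p , i , step) → p , punchIn′ r i , step

  removeTile-terminal : ∀ {r A} → Redundant T r → Terminal (removeTile T r) A → Terminal T A
  removeTile-terminal {r} {A} redundant (produced , stuck) =
    produced′ , λ (_ , _ , _ , ext , _) → blocked ext
    where
    produced′ = removeTile-produces produced
    blocked-other : ∀ {q j} → j ≢ r → ¬ CanExtendAt T A q j
    blocked-other j≢r ext with punchIn′-punchOut j≢r
    ... | i , refl = stuck (canExtend⇒step {T = removeTile T r} ext)
    blocked : ∀ {q j} → ¬ CanExtendAt T A q j
    blocked {j = j} ext with j ≟ᶠ r
    ... | yes refl = let (j′ , j′≢r , ext′) = redundant produced′ ext in blocked-other j′≢r ext′
    ... | no j≢r   = blocked-other j≢r ext

  removeTile-isSolution : ∀ {m n k} {c : Colouring m n k} {r} →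
                          IsSolution c T → Redundant T r → IsSolution c (removeTile T r)
  removeTile-isSolution {c = c} {r} (τ≡2 , unit , seedDom , terminalDom , d , coloured) redundant =
    τ≡2 , unit ∘ punchIn′ r , seedDom , (λ A → terminalDom A ∘ terminal) ,
    d ∘ punchIn′ r , coloured′
    where
    terminal : ∀ {A} → Terminal (removeTile T r) A → Terminal T A
    terminal = removeTile-terminal redundant
    coloured′ : ∀ A → Terminal (removeTile T r) A → ∀ x y →
                ∃ λ i → A (cellPos x y) ≡ just (tiles T (punchIn′ r i)) × d (punchIn′ r i) ≡ c x y
    coloured′ A term x y with coloured A (terminal term) x y
                            | produced⇒seedOrTile {T = removeTile T r} (proj₁ term) (cellPos x y)
    ... | j , at , dj | inj₂ (i , at′) =
      i , at′ , trans (cong d (tiles-inj T (just-injective (trans (sym at′) at)))) dj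
    ... | j , at , _  | inj₁ seed-at =
      ⊥-elim (cellPos∉SeedDom x y (proj₁ (seedDom _) (_ , trans (sym seed-at) at)))

module Attachment {Glue : Set} {m n : ℕ} (T : TAS Glue) (τ≡2 : τ T ≡ 2) (unit : UnitStrength T)
                  (seedDom : HasDomain (seed T) (SeedDom m n)) where

  record Supported (A : Assembly Glue) : Set where
    field
      inRect   : ∀ q → Defined A q → RectDom m n q
      seed⊆    : ∀ q → SeedDom m n q → Defined A q
      leans-on : ∀ q → Defined A q → ¬ SeedDom m n q → Defined A (dirW q) × Defined A (dirS q)
  open Supported

  record BindsSouthWest (A : Assembly Glue) (p : Pos) (t : Tile Glue) : Set where
    field
      north-free : A (dirN p) ≡ nothing
      east-free  : A (dirE p) ≡ nothing
      south      : Tile Glue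
      south-at   : A (dirS p) ≡ just south
      south-bond : str T (σS t) (σN south) ≡ 1
      west       : Tile Glue
      west-at    : A (dirW p) ≡ just west
      west-bond  : str T (σW t) (σE west) ≡ 1
  open BindsSouthWest

  τ≤⇒2≤ : ∀ {k} → τ T ≤ k → 2 ≤ k
  τ≤⇒2≤ {k} = subst (_≤ k) τ≡2

  bindsSouthWest⇒τ≤ : ∀ {A p t} → BindsSouthWest A p t → τ T ≤ bindStrength T A p t
  bindsSouthWest⇒τ≤ {A} {p} {t} b = subst (_≤ bindStrength T A p t) (sym τ≡2) (two-bonds b)
    where
    two-bonds : ∀ {A p t} → BindsSouthWest A p t → 2 ≤ bindStrength T A p t
    two-bonds b rewrite north-free b | east-free b | south-at b | west-at b
                      | south-bond b | west-bond b = ≤-refl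

  outside-free : ∀ {A} → Supported A → ∀ {q} (f : Tile Glue → ℕ) →
                 ¬ RectDom m n q → contrib T (A q) f ≡ 0
  outside-free {A} sup f ∉rect = contrib-nothing T f (free {A = A} (∉rect ∘ inRect sup _))

  canExtend-nonnegative : ∀ {A x y r} → Supported A → CanExtendAt T A (x , y) r →
                          + 0 ℤ.≤ x × + 0 ℤ.≤ y
  canExtend-nonnegative {A} {x} {y} {r} sup (_ , τ≤) = 0≤x , 0≤y
    where
    2≤ = τ≤⇒2≤ τ≤
    0≤x = decidable-stable (+ 0 ℤ.≤? x) λ 0≰x → <⇒≱ (lone-east
      (contrib≤1 T (A (dirE (x , y))) σW (proj₁ (proj₂ (unit r))))
      (outside-free sup _ λ ((0≤x , _) , _) → 0≰x 0≤x)
      (outside-free sup _ λ ((0≤x , _) , _) → 0≰x 0≤x)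
      (outside-free sup _ λ ((0≤x-1 , _) , _) → 0≰x (0≤i-1⇒0≤i 0≤x-1))) 2≤
    0≤y = decidable-stable (+ 0 ℤ.≤? y) λ 0≰y → <⇒≱ (lone-north
      (contrib≤1 T (A (dirN (x , y))) σS (proj₁ (unit r)))
      (outside-free sup _ λ (_ , 0≤y , _) → 0≰y 0≤y)
      (outside-free sup _ λ (_ , 0≤y-1 , _) → 0≰y (0≤i-1⇒0≤i 0≤y-1))
      (outside-free sup _ λ (_ , 0≤y , _) → 0≰y 0≤y)) 2≤

  canExtend-north-east-free : ∀ {A x y r} → Supported A → CanExtendAt T A (x , y) r →
                              A (dirN (x , y)) ≡ nothing × A (dirE (x , y)) ≡ nothing
  -- A present north or east neighbour is not a seed tile, so it would lean on the empty position.
  canExtend-north-east-free {A} {x} {y} sup ext@(empty , _) =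
    free {A = A} (λ defN → vacant (subst (Defined A) (dirS-dirN (x , y))
                                         (proj₂ (leans-on sup _ defN north∉seed)))) ,
    free {A = A} (λ defE → vacant (subst (Defined A) (dirW-dirE (x , y))
                                         (proj₁ (leans-on sup _ defE east∉seed))))
    where
    0≤x = proj₁ (canExtend-nonnegative sup ext)
    0≤y = proj₂ (canExtend-nonnegative sup ext)
    vacant : ¬ Defined A (x , y)
    vacant (t , at) = contradiction (trans (sym empty) at) λ ()
    north∉seed : ¬ SeedDom m n (x , y ℤ.+ 1ℤ)
    north∉seed (inj₁ (_ , y+1≡0))        = 0≤i⇒i+1≢0 0≤y y+1≡0
    north∉seed (inj₂ (x≡0 , _ , y+1≤n)) =
      vacant (seed⊆ sup _ (inj₂ (x≡0 , 0≤y , ℤ.≤-trans (ℤ.i≤i+j y 1ℤ) y+1≤n)))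
    east∉seed : ¬ SeedDom m n (x ℤ.+ 1ℤ , y)
    east∉seed (inj₁ ((_ , x+1≤m) , y≡0)) =
      vacant (seed⊆ sup _ (inj₁ ((0≤x , ℤ.≤-trans (ℤ.i≤i+j x 1ℤ) x+1≤m) , y≡0)))
    east∉seed (inj₂ (x+1≡0 , _))         = 0≤i⇒i+1≢0 0≤x x+1≡0

  canExtend⇒bindsSouthWest : ∀ {A p r} → Supported A → CanExtendAt T A p r →
                             BindsSouthWest A p (tiles T r)
  canExtend⇒bindsSouthWest {A} {x , y} {r} sup ext@(_ , τ≤) = record
    { north-free = proj₁ free-NE ; east-free = proj₂ free-NE
    ; south = proj₁ S ; south-at = proj₁ (proj₂ S) ; south-bond = proj₂ (proj₂ S)
    ; west  = proj₁ W ; west-at  = proj₁ (proj₂ W) ; west-bond  = proj₂ (proj₂ W)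
    }
    where
    t = tiles T r
    free-NE = canExtend-north-east-free sup ext
    bonds = south-west-only
      (contrib≤1 T (A (dirS (x , y))) σN (proj₁ (proj₂ (proj₂ (unit r)))))
      (contrib≤1 T (A (dirW (x , y))) σE (proj₂ (proj₂ (proj₂ (unit r)))))
      (contrib-nothing T _ (proj₁ free-NE)) (contrib-nothing T _ (proj₂ free-NE)) (τ≤⇒2≤ τ≤)
    S = contrib≡1 T (A (dirS (x , y))) (λ u → str T (σS t) (σN u)) (proj₁ bonds)
    W = contrib≡1 T (A (dirW (x , y))) (λ u → str T (σW t) (σE u)) (proj₂ bonds)

  seed-supported : Supported (seed T)
  seed-supported = record
    { inRect   = λ q defined → SeedDom⇒RectDom q (proj₁ (seedDom q) defined)
    ; seed⊆    = λ q → proj₂ (seedDom q)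
    ; leans-on = λ q defined ∉seed → contradiction (proj₁ (seedDom q) defined) ∉seed
    }

  step-supported : ∀ {A A′} → Supported A → Step T A A′ → Supported A′
  step-supported {A} {A′} sup ((x , y) , r , ext , at-p , elsewhere) = record
    { inRect   = inRect′
    ; seed⊆    = λ q → grow ∘ seed⊆ sup q
    ; leans-on = leans-on′
    }
    where
    b = canExtend⇒bindsSouthWest sup ext
    south-defined : Defined A (x , y ℤ.- 1ℤ)
    south-defined = south b , south-at b
    west-defined : Defined A (x ℤ.- 1ℤ , y)
    west-defined = west b , west-at b
    grow : ∀ {q} → Defined A q → Defined A′ q
    grow {q} (t , at) with q ≟ₚ (x , y)
    ... | yes refl = _ , at-p
    ... | no q≢p   = t , trans (elsewhere q q≢p) at
    shrink : ∀ {q} → q ≢ (x , y) → Defined A′ q → Defined A q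
    shrink {q} q≢p (t , at) = t , trans (sym (elsewhere q q≢p)) at
    inRect′ : ∀ q → Defined A′ q → RectDom m n q
    inRect′ q defined with q ≟ₚ (x , y)
    ... | yes refl = proj₁ (inRect sup _ south-defined) , proj₂ (inRect sup _ west-defined)
    ... | no q≢p   = inRect sup q (shrink q≢p defined)
    leans-on′ : ∀ q → Defined A′ q → ¬ SeedDom m n q → Defined A′ (dirW q) × Defined A′ (dirS q)
    leans-on′ q defined ∉seed with q ≟ₚ (x , y)
    ... | yes refl = grow west-defined , grow south-defined
    ... | no q≢p   = let (west-q , south-q) = leans-on sup q (shrink q≢p defined) ∉seed
                     in grow west-q , grow south-q

  produced⇒supported : ∀ {A} → Produces T A → Supported A
  produced⇒supported = Star-invariant Supported step-supported seed-supported

  canExtend-transfer : ∀ {A₀ A p q r r′} → Supported A₀ → Supported A →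
                       CanExtendAt T A₀ p r → CanExtendAt T A₀ p r′ →
                       CanExtendAt T A q r′ → CanExtendAt T A q r
  canExtend-transfer {A = A} {q = q} {r} sup₀ sup ext₀ ext₀′ ext′@(empty , _) =
    empty , bindsSouthWest⇒τ≤ {A} {q} {tiles T r} record
    { north-free = north-free b′ ; east-free = east-free b′
    ; south = south b′ ; south-at = south-at b′
    ; south-bond = str-zigzag T (proj₁ (proj₂ (proj₂ (unit r)))) (south-bond b₀)
        (subst (λ u → str T _ (σN u) ≡ 1) same-south (south-bond b₀′)) (south-bond b′)
    ; west = west b′ ; west-at = west-at b′
    ; west-bond = str-zigzag T (proj₂ (proj₂ (proj₂ (unit r)))) (west-bond b₀)
        (subst (λ u → str T _ (σE u) ≡ 1) same-west (west-bond b₀′)) (west-bond b′)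
    }
    where
    b₀  = canExtend⇒bindsSouthWest sup₀ ext₀
    b₀′ = canExtend⇒bindsSouthWest sup₀ ext₀′
    b′  = canExtend⇒bindsSouthWest sup ext′
    same-south : south b₀′ ≡ south b₀
    same-south = just-injective (trans (sym (south-at b₀′)) (south-at b₀))
    same-west : west b₀′ ≡ west b₀
    same-west = just-injective (trans (sym (west-at b₀′)) (west-at b₀))

  competing⇒redundant : ∀ {A₀ p r r′} → Produces T A₀ → r ≢ r′ →
                        CanExtendAt T A₀ p r → CanExtendAt T A₀ p r′ → Redundant T r′
  competing⇒redundant {r = r} produced₀ r≢r′ ext₀ ext₀′ produced ext′ =
    r , r≢r′ , canExtend-transfer (produced⇒supported produced₀) (produced⇒supported produced)
                                  ext₀ ext₀′ ext′

lemma1 : (m n k : ℕ) → 1 ≤ m → 1 ≤ n → 1 ≤ k →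
    (c : Colouring m n k) → Onto c →
    {Glue : Set} (𝒯 : TAS Glue) → IsSolution c 𝒯 →
    (∀ (Glue′ : Set) (𝒯′ : TAS Glue′) → IsSolution c 𝒯′ → size 𝒯 ≤ size 𝒯′) →
    Deterministic 𝒯
lemma1 m n k _ _ _ c _ {Glue} T solution@(τ≡2 , unit , seedDom , _) minimal
       A₀ produced₀ p r r′ ext ext′ with r ≟ᶠ r′
... | yes r≡r′ = r≡r′
... | no r≢r′  = contradiction (minimal Glue (removeTile T r′) smaller)
                               (<⇒≱ (removeTile-size< {T = T} r′))
  where
  open Attachment T τ≡2 unit seedDom
  smaller : IsSolution c (removeTile T r′)
  smaller = removeTile-isSolution {T = T} solution (competing⇒redundant produced₀ r≢r′ ext ext′)
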